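{- Let $\omega'$ be the binary sequence defined as follows. Then $\lim_{n\to\infty}\frac{L_n(\omega')}{\log_2 n}=0$. For each integer $i\ge1$ let $p_1,\dots,p_{2^i}$ be all blocks in $\{0,1\}^i$ in increasing order, where $p_j$ is the $i$-digit binary notation of $j-1$. Let $w_i=p_1^{\lceil i2^i\log i\rceil}\cdots p_{2^i}^{\lceil i2^i\log i\rceil}$ and $\omega=w_1^{l_1}w_2^{l_2}\cdots$ with $l_i=i^{2^i}$. The sequence $\omega'$ is obtained from $\omega$ by replacing, in every copy of every $w_i$, the final block $p_{2^i}^{\lceil i2^i\log i\rceil}=1^{i\lceil i2^i\log i\rceil}$ (the maximal run of ones at the end of $w_i$) by zeros.
   Context: $u^l$ denotes the concatenation of $l$ copies of a block $u$. For a binary sequence $x$, $L_n(x)$ is the length of the longest run of consecutive ones among its first $n$ digits. -}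

module Defs where

open import Data.Bool using (Bool; true; false)
open import Data.Nat using (ℕ; zero; suc; _+_; _*_; _∸_; _^_; _≤_; _<_; _≡ᵇ_; _!; _⊔_)
open import Data.Nat.DivMod using (_/_; _%_)
open import Data.List using (List; []; _∷_; _++_; concat; replicate; map; upTo; reverse; take)
open import Data.Sum using (_⊎_)
open import Data.Product using (∃)
open import Relation.Binary.PropositionalEquality using (_≡_)

-- Exponential function, via exact Taylor partial sums (no reals).
-- T m K = Σ_{k ≤ K} m^k · K!/k!, so that Σ_{k ≤ K} m^k/k! = T m K / K!.
T : ℕ → ℕ → ℕ
T m zero    = 1
T m (suc K) = suc K * T m K + m ^ suc K

-- e^m ≥ N   (some Taylor partial sum of e^m reaches N)
ExpGe : ℕ → ℕ → Set
ExpGe m N = ∃ λ K → N * (K !) ≤ T m K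

-- e^m < N   (every Taylor partial sum of e^m stays below N)
ExpLt : ℕ → ℕ → Set
ExpLt m N = ∀ K → T m K < N * (K !)

-- c = ⌈ i·2^i·ln i ⌉ (for i ≥ 1), i.e.  c-1 < i·2^i·ln i ≤ c,
-- i.e.  e^(c-1) < i^(i·2^i) ≤ e^c   (with c = 0 allowed iff the value is ≤ 0).
IsCeilLog : ℕ → ℕ → Set
IsCeilLog i c = ExpGe c (i ^ (i * 2 ^ i)) × (c ≡ 0 ⊎ ExpLt (c ∸ 1) (i ^ (i * 2 ^ i)))
  where open import Data.Product using (_×_)

-- Binary blocks.  true = digit 1, false = digit 0.

lsb : ℕ → ℕ → List Bool
lsb zero    m = []
lsb (suc i) m = (m % 2 ≡ᵇ 1) ∷ lsb i (m / 2)

bin : ℕ → ℕ → List Bool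
bin i m = reverse (lsb i m)

pow : {A : Set} → List A → ℕ → List A
pow u l = concat (replicate l u)

-- w'_i given c = ⌈i 2^i log i⌉ : p_1^c ⋯ p_{2^i - 1}^c followed by
-- the final block p_{2^i}^c = 1^{i c} replaced by zeros.
w' : ℕ → ℕ → List Bool
w' i c = concat (map (λ j → pow (bin i j) c) (upTo (2 ^ i ∸ 1))) ++ replicate (i * c) false

l : ℕ → ℕ
l i = i ^ (2 ^ i)

-- Prefix  w'_1^{l_1} w'_2^{l_2} ⋯ w'_k^{l_k}  of ω', for a given ceiling function c.
pre : (ℕ → ℕ) → ℕ → List Bool
pre c zero    = []
pre c (suc k) = pre c k ++ pow (w' (suc k) (c (suc k))) (l (suc k))

-- n-th element with default (default never used for the prefixes below).
nth : List Bool → ℕ → Bool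
nth []       n       = false
nth (x ∷ xs) zero    = x
nth (x ∷ xs) (suc n) = nth xs n

-- The sequence ω' (0-indexed); pre c (n+2) has length > n.
ω' : (ℕ → ℕ) → ℕ → Bool
ω' c n = nth (pre c (suc (suc n))) n

runAux : ℕ → ℕ → List Bool → ℕ
runAux cur best []           = best
runAux cur best (true ∷ xs)  = runAux (suc cur) (best ⊔ suc cur) xs
runAux cur best (false ∷ xs) = runAux 0 best xs

longestRun : List Bool → ℕ
longestRun = runAux 0 0

L : (ℕ → Bool) → ℕ → ℕ
L x n = longestRun (map x (upTo n))

-- In w'_i every i-digit block p_j before the last one contains a zero, and the final block of
-- ones has been replaced by zeros.  A run of ones can therefore only join the trailing ones of
-- one block to the leading ones of the next, so it has length at most 2i, and the prefix of ω'
-- up to the end of w'_j^{l_j} has no run longer than 2j.  A position n beyond that prefix has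
-- n > l_j = j^(2^j) ≥ 2^(2^j), i.e. ⌊log₂ n⌋ ≥ 2^j, which dominates k·2(j+1) once j ≥ 4k.
module Submission where

open import Defs
open import Data.Nat using (ℕ; _*_; _≤_; _≥_)
open import Data.Nat.Logarithm using (⌊log₂_⌋)
open import Data.Product using (∃)

open import Data.Nat using (zero; suc; _+_; _∸_; _^_; _<_; _!; z≤n; s≤s; _≡ᵇ_; _≤?_)
open import Data.Nat.Properties
open import Data.Nat.DivMod using (_/_; _%_; m≡m%n+[m/n]*n)
open import Data.Nat.Logarithm using (⌊log₂⌋-mono-≤; ⌊log₂[2^n]⌋≡n)
open import Data.Nat.Tactic.RingSolver using (solve-∀)
open import Data.Bool using (Bool; true; false) renaming (T to IsTrue)
open import Data.Bool.Properties using () renaming (_≟_ to _≟ᴮ_)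
open import Data.List using (List; []; _∷_; _++_; concat; replicate; map; upTo; take; length; applyUpTo)
open import Data.List.Properties using (length-++; length-reverse; length-replicate; ++-assoc; ++-identityʳ; map-upTo)
open import Data.List.Membership.Propositional using (_∈_)
open import Data.List.Relation.Unary.All as All using (All)
open import Data.List.Relation.Unary.All.Properties using (applyUpTo⁺₁) renaming (map⁺ to All-map⁺)
open import Data.List.Relation.Unary.Any using (here; there; any?)
open import Data.List.Relation.Unary.Any.Properties using (reverse⁺)
open import Data.Product using (_×_; _,_; proj₂)
open import Data.Sum using (inj₁; inj₂)
open import Relation.Nullary using (¬_; yes; no; contradiction)
open import Relation.Binary.PropositionalEquality
open import Function using (_∘_; id)

-- Runs d c e xs: scanning xs from a current run of c ones, every run stays ≤ d and the run
-- current at the end of xs is e.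
data Runs (d : ℕ) : ℕ → ℕ → List Bool → Set where
  end   : ∀ {c} → Runs d c c []
  one   : ∀ {c e xs} → suc c ≤ d → Runs d (suc c) e xs → Runs d c e (true ∷ xs)
  reset : ∀ {c e xs} → Runs d 0 e xs → Runs d c e (false ∷ xs)

Runs-++ : ∀ {d c e f xs ys} → Runs d c e xs → Runs d e f ys → Runs d c f (xs ++ ys)
Runs-++ end         s = s
Runs-++ (one c<d r) s = one c<d (Runs-++ r s)
Runs-++ (reset r)   s = reset (Runs-++ r s)

Runs-mono : ∀ {d d′ c e xs} → d ≤ d′ → Runs d c e xs → Runs d′ c e xs
Runs-mono d≤d′ end         = end
Runs-mono d≤d′ (one c<d r) = one (≤-trans c<d d≤d′) (Runs-mono d≤d′ r)
Runs-mono d≤d′ (reset r)   = reset (Runs-mono d≤d′ r)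

Runs-take : ∀ {d c e xs} n → Runs d c e xs → ∃ λ e′ → Runs d c e′ (take n xs)
Runs-take zero    r           = _ , end
Runs-take (suc n) end         = _ , end
Runs-take (suc n) (one c<d r) = let e′ , r′ = Runs-take n r in e′ , one c<d r′
Runs-take (suc n) (reset r)   = let e′ , r′ = Runs-take n r in e′ , reset r′

Runs-exists : ∀ {d} c xs → c + length xs ≤ d → ∃ λ e → Runs d c e xs
Runs-exists     c []           _     = c , end
Runs-exists {d} c (true ∷ xs)  c+n≤d =
  let c+1+n≤d = subst (_≤ d) (+-suc c (length xs)) c+n≤d
      e , r   = Runs-exists (suc c) xs c+1+n≤d
  in  e , one (≤-trans (m≤m+n (suc c) (length xs)) c+1+n≤d) r
Runs-exists     c (false ∷ xs) c+n≤d =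
  let e , r = Runs-exists 0 xs (≤-trans (n≤1+n _) (≤-trans (m≤n+m _ c) c+n≤d)) in e , reset r

Runs-final≤ : ∀ {d c e xs} → Runs d c e xs → e ≤ c + length xs
Runs-final≤ {c = c} end = ≤-reflexive (sym (+-identityʳ c))
Runs-final≤ {c = c} {e} {_ ∷ xs} (one _ r) =
  subst (e ≤_) (sym (+-suc c (length xs))) (Runs-final≤ r)
Runs-final≤ {c = c} {xs = _ ∷ xs} (reset r) =
  ≤-trans (Runs-final≤ r) (≤-trans (n≤1+n _) (m≤n+m _ c))

Runs-final≤length : ∀ {d c e xs} → Runs d c e xs → false ∈ xs → e ≤ length xs
Runs-final≤length (one _ r) (there 0∈xs) = m≤n⇒m≤1+n (Runs-final≤length r 0∈xs)
Runs-final≤length (reset r) _            = m≤n⇒m≤1+n (Runs-final≤ r)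

runAux≤ : ∀ {d c e xs} best → best ≤ d → Runs d c e xs → runAux c best xs ≤ d
runAux≤ best best≤d end         = best≤d
runAux≤ best best≤d (one c<d r) = runAux≤ _ (⊔-lub best≤d c<d) r
runAux≤ best best≤d (reset r)   = runAux≤ best best≤d r

longestRun-take≤ : ∀ {d e xs} n → Runs d 0 e xs → longestRun (take n xs) ≤ d
longestRun-take≤ n r = runAux≤ 0 z≤n (proj₂ (Runs-take n r))

CarryBounded : ℕ → ℕ → List Bool → Set
CarryBounded d b xs = ∀ c → c ≤ b → ∃ λ e → e ≤ b × Runs d c e xs

carry-[] : ∀ {d b} → CarryBounded d b []
carry-[] c c≤b = c , c≤b , end

carry-++ : ∀ {d b xs ys} → CarryBounded d b xs → CarryBounded d b ys → CarryBounded d b (xs ++ ys)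
carry-++ P Q c c≤b =
  let e , e≤b , r = P c c≤b
      f , f≤b , s = Q e e≤b
  in  f , f≤b , Runs-++ r s

carry-concat : ∀ {d b xss} → All (CarryBounded d b) xss → CarryBounded d b (concat xss)
carry-concat All.[]       = carry-[]
carry-concat (P All.∷ Ps) = carry-++ P (carry-concat Ps)

carry-pow : ∀ {d b xs} n → CarryBounded d b xs → CarryBounded d b (pow xs n)
carry-pow zero    P = carry-[]
carry-pow (suc n) P = carry-++ P (carry-pow n P)

carry-zeros : ∀ {d b} n → CarryBounded d b (replicate n false)
carry-zeros zero    = carry-[]
carry-zeros (suc n) c c≤b = let e , e≤b , r = carry-zeros n 0 z≤n in e , e≤b , reset r

carry-block : ∀ {b xs} → length xs ≤ b → false ∈ xs → CarryBounded (b + b) b xs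
carry-block {b} {xs} |xs|≤b 0∈xs c c≤b =
  let e , r = Runs-exists c xs (+-mono-≤ c≤b |xs|≤b)
  in  e , ≤-trans (Runs-final≤length r 0∈xs) |xs|≤b , r

length-lsb : ∀ i m → length (lsb i m) ≡ i
length-lsb zero    m = refl
length-lsb (suc i) m = cong suc (length-lsb i (m / 2))

length-bin : ∀ i m → length (bin i m) ≡ i
length-bin i m = trans (length-reverse (lsb i m)) (length-lsb i m)

lsb-all-ones : ∀ i m → ¬ false ∈ lsb i m → 2 ^ i ≤ suc m
lsb-all-ones zero    m _ = s≤s z≤n
lsb-all-ones (suc i) m 0∉ with m % 2 ≡ᵇ 1 in odd
... | false = contradiction (here refl) 0∉
... | true  = begin
    2 * 2 ^ i               ≤⟨ *-monoʳ-≤ 2 (lsb-all-ones i q (0∉ ∘ there)) ⟩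
    2 * suc q               ≡⟨ *-suc 2 q ⟩
    2 + 2 * q               ≡⟨ cong (2 +_) (*-comm 2 q) ⟩
    suc (1 + q * 2)         ≡⟨ cong (λ r → suc (r + q * 2)) (sym m%2≡1) ⟩
    suc (m % 2 + q * 2)     ≡⟨ cong suc (sym (m≡m%n+[m/n]*n m 2)) ⟩
    suc m                   ∎
  where
  open ≤-Reasoning
  q = m / 2
  m%2≡1 : m % 2 ≡ 1
  m%2≡1 = ≡ᵇ⇒≡ (m % 2) 1 (subst IsTrue (sym odd) _)

bin-has-zero : ∀ i j → j < 2 ^ i ∸ 1 → false ∈ bin i j
bin-has-zero i j j<2^i∸1 with any? (false ≟ᴮ_) (lsb i j)
... | yes 0∈lsb = reverse⁺ 0∈lsb
... | no  0∉lsb = contradiction (lsb-all-ones i j 0∉lsb) (<⇒≱ 1+j<2^i)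
  where
  1+j<2^i : suc j < 2 ^ i
  1+j<2^i = ≤-trans (s≤s j<2^i∸1) (≤-reflexive (trans (+-comm 1 _) (m∸n+n≡m (m^n>0 2 i))))

carry-w' : ∀ i c → CarryBounded (i + i) i (w' i c)
carry-w' i c = carry-++ (carry-concat (All-map⁺ (applyUpTo⁺₁ id (2 ^ i ∸ 1) block)))
                        (carry-zeros (i * c))
  where
  block : ∀ {j} → j < 2 ^ i ∸ 1 → CarryBounded (i + i) i (pow (bin i j) c)
  block {j} j<2^i∸1 = carry-pow c (carry-block (≤-reflexive (length-bin i j)) (bin-has-zero i j j<2^i∸1))

length-pow : ∀ (xs : List Bool) n → length (pow xs n) ≡ n * length xs
length-pow xs zero    = refl
length-pow xs (suc n) = trans (length-++ xs) (cong (length xs +_) (length-pow xs n))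

length-w'≥ : ∀ i c → i * c ≤ length (w' i c)
length-w'≥ i c = begin
    i * c                                            ≡⟨ sym (length-replicate (i * c)) ⟩
    length (replicate (i * c) false)                 ≤⟨ m≤n+m _ (length blocks) ⟩
    length blocks + length (replicate (i * c) false) ≡⟨ sym (length-++ blocks) ⟩
    length (w' i c)                                  ∎
  where
  open ≤-Reasoning
  blocks = concat (map (λ j → pow (bin i j) c) (upTo (2 ^ i ∸ 1)))

nth-++ˡ : ∀ xs ys {i} → i < length xs → nth (xs ++ ys) i ≡ nth xs i
nth-++ˡ (x ∷ xs) ys {zero}  _         = refl
nth-++ˡ (x ∷ xs) ys {suc i} (s≤s i<n) = nth-++ˡ xs ys i<n

applyUpTo-nth : ∀ xs n → n ≤ length xs → applyUpTo (nth xs) n ≡ take n xs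
applyUpTo-nth xs       zero    _         = refl
applyUpTo-nth (x ∷ xs) (suc n) (s≤s n≤) = cong (x ∷_) (applyUpTo-nth xs n n≤)

applyUpTo-cong : ∀ {A : Set} (f g : ℕ → A) n → (∀ {i} → i < n → f i ≡ g i) →
                 applyUpTo f n ≡ applyUpTo g n
applyUpTo-cong f g zero    _   = refl
applyUpTo-cong f g (suc n) f≗g =
  cong₂ _∷_ (f≗g (s≤s z≤n)) (applyUpTo-cong (f ∘ suc) (g ∘ suc) n (f≗g ∘ s≤s))

bracket : ∀ (f : ℕ → ℕ) {n} m → f 0 < n → n ≤ f m → ∃ λ j → f j < n × n ≤ f (suc j)
bracket f zero    f0<n n≤f0 = contradiction n≤f0 (<⇒≱ f0<n)
bracket f {n} (suc m) f0<n n≤fm+1 with n ≤? f m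
... | yes n≤fm = bracket f m f0<n n≤fm
... | no  n≰fm = m , ≰⇒> n≰fm , n≤fm+1

1+n≤2^n : ∀ n → suc n ≤ 2 ^ n
1+n≤2^n zero    = s≤s z≤n
1+n≤2^n (suc n) = +-mono-≤ (m^n>0 2 n) (≤-trans (1+n≤2^n n) (m≤m+n _ 0))

n*[1+n]≤2*2^n : ∀ n → n * suc n ≤ 2 * 2 ^ n
n*[1+n]≤2*2^n zero    = z≤n
n*[1+n]≤2*2^n (suc n) = begin
    suc n * suc (suc n)      ≡⟨ expand n ⟩
    n * suc n + 2 * suc n    ≤⟨ +-mono-≤ (n*[1+n]≤2*2^n n) (*-monoʳ-≤ 2 (1+n≤2^n n)) ⟩
    2 * 2 ^ n + 2 * 2 ^ n    ≡⟨ double (2 ^ n) ⟩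
    2 * 2 ^ suc n            ∎
  where
  open ≤-Reasoning
  expand : ∀ n → suc n * suc (suc n) ≡ n * suc n + 2 * suc n
  expand = solve-∀
  double : ∀ x → 2 * x + 2 * x ≡ 2 * (2 * x)
  double = solve-∀

run-budget : ∀ k j → 4 * k ≤ j → k * (suc j + suc j) ≤ 2 ^ j
run-budget k j 4k≤j = *-cancelˡ-≤ 2 (begin
    2 * (k * (suc j + suc j)) ≡⟨ regroup k j ⟩
    4 * k * suc j             ≤⟨ *-monoˡ-≤ (suc j) 4k≤j ⟩
    j * suc j                 ≤⟨ n*[1+n]≤2*2^n j ⟩
    2 * 2 ^ j                 ∎)
  where
  open ≤-Reasoning
  regroup : ∀ k j → 2 * (k * (suc j + suc j)) ≡ 4 * k * suc j
  regroup = solve-∀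

n≤l : ∀ n → 1 ≤ n → n ≤ l n
n≤l n@(suc _) _ = ≤-trans (≤-reflexive (sym (*-identityʳ n))) (^-monoʳ-≤ n (m^n>0 2 n))

T-zero : ∀ K → T 0 K ≡ K !
T-zero zero    = refl
T-zero (suc K) = trans (+-identityʳ _) (cong (suc K *_) (T-zero K))

2≤i^[i*2^i] : ∀ i → 2 ≤ i → 2 ≤ i ^ (i * 2 ^ i)
2≤i^[i*2^i] i@(suc _) 2≤i =
  ≤-trans 2≤i (≤-trans (≤-reflexive (sym (*-identityʳ i))) (^-monoʳ-≤ i (*-mono-≤ {1} {i} (s≤s z≤n) (m^n>0 2 i))))

-- e^0 = 1 < i^(i·2^i), so the ceiling of its logarithm is positive.
ceilLog-pos : ∀ {i c} → 2 ≤ i → IsCeilLog i c → 1 ≤ c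
ceilLog-pos {i} {zero} 2≤i ((K , N*K!≤T) , _) =
  contradiction (≤-trans N*K!≤T (≤-reflexive (T-zero K))) (<⇒≱ K!<N*K!)
  where
  N = i ^ (i * 2 ^ i)
  K!<N*K! : K ! < N * K !
  K!<N*K! = subst (K ! <_) (*-comm (K !) N) (m<m*n (K !) N {{K !≢0}} (2≤i^[i*2^i] i 2≤i))
ceilLog-pos {c = suc _} _ _ = s≤s z≤n

module _ (c : ℕ → ℕ) where

  Runs-pre : ∀ m → ∃ λ e → e ≤ m × Runs (m + m) 0 e (pre c m)
  Runs-pre zero    = 0 , z≤n , end
  Runs-pre (suc m) =
    let e , e≤m , r   = Runs-pre m
        f , f≤1+m , s = carry-pow (l (suc m)) (carry-w' (suc m) (c (suc m))) e (m≤n⇒m≤1+n e≤m)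
    in  f , f≤1+m , Runs-++ (Runs-mono (+-mono-≤ (n≤1+n m) (n≤1+n m)) r) s

  length-pre-suc : ∀ m → length (pre c (suc m)) ≡ length (pre c m) + l (suc m) * length (w' (suc m) (c (suc m)))
  length-pre-suc m = trans (length-++ (pre c m)) (cong (length (pre c m) +_) (length-pow _ (l (suc m))))

  pre-extend : ∀ a k → ∃ λ ys → pre c (k + a) ≡ pre c a ++ ys
  pre-extend a zero    = [] , sym (++-identityʳ (pre c a))
  pre-extend a (suc k) =
    let ys , eq = pre-extend a k
        next    = pow (w' (suc (k + a)) (c (suc (k + a)))) (l (suc (k + a)))
    in  ys ++ next , trans (cong (_++ next) eq) (++-assoc (pre c a) ys next)

  pre-prefix : ∀ {a b} → a ≤ b → ∃ λ ys → pre c b ≡ pre c a ++ ys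
  pre-prefix {a} {b} a≤b = subst (λ m → ∃ λ ys → pre c m ≡ pre c a ++ ys) (m∸n+n≡m a≤b) (pre-extend a (b ∸ a))

  length-pre-mono : ∀ {a b} → a ≤ b → length (pre c a) ≤ length (pre c b)
  length-pre-mono {a} a≤b with pre-prefix a≤b
  ... | ys , eq = subst (_ ≤_) (trans (sym (length-++ (pre c a))) (cong length (sym eq))) (m≤m+n _ (length ys))

  nth-pre-agree : ∀ {a b i} → a ≤ b → i < length (pre c a) → nth (pre c b) i ≡ nth (pre c a) i
  nth-pre-agree {a} a≤b i<n with pre-prefix a≤b
  ... | ys , eq = trans (cong (λ xs → nth xs _) eq) (nth-++ˡ (pre c a) ys i<n)

module _ (c : ℕ → ℕ) (ceil : ∀ i → 1 ≤ i → IsCeilLog i (c i)) where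

  l≤length-pre : ∀ j → 2 ≤ j → l j ≤ length (pre c j)
  l≤length-pre (suc j) 2≤1+j = begin
      l (suc j)                                 ≡⟨ sym (*-identityʳ _) ⟩
      l (suc j) * 1                             ≤⟨ *-monoʳ-≤ (l (suc j)) 1≤|w'| ⟩
      l (suc j) * length w'ⱼ                    ≤⟨ m≤n+m _ (length (pre c j)) ⟩
      length (pre c j) + l (suc j) * length w'ⱼ ≡⟨ sym (length-pre-suc c j) ⟩
      length (pre c (suc j))                    ∎
    where
    open ≤-Reasoning
    w'ⱼ = w' (suc j) (c (suc j))
    1≤|w'| : 1 ≤ length w'ⱼ
    1≤|w'| = ≤-trans (*-mono-≤ {1} {suc j} (s≤s z≤n) (ceilLog-pos 2≤1+j (ceil (suc j) (s≤s z≤n))))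
                     (length-w'≥ (suc j) (c (suc j)))

  <length-pre : ∀ i → i < length (pre c (2 + i))
  <length-pre i = ≤-trans (n≤1+n (suc i)) (≤-trans (n≤l (2 + i) (s≤s z≤n)) (l≤length-pre (2 + i) (s≤s (s≤s z≤n))))

  ω'≡nth-pre : ∀ {m i} → i < length (pre c m) → ω' c i ≡ nth (pre c m) i
  ω'≡nth-pre {m} {i} i<|pre| with ≤-total (2 + i) m
  ... | inj₁ 2+i≤m = sym (nth-pre-agree c 2+i≤m (<length-pre i))
  ... | inj₂ m≤2+i = nth-pre-agree c m≤2+i i<|pre|

  ω'-prefix : ∀ {m n} → n ≤ length (pre c m) → map (ω' c) (upTo n) ≡ take n (pre c m)
  ω'-prefix {m} {n} n≤|pre| = begin
      map (ω' c) (upTo n)          ≡⟨ map-upTo (ω' c) n ⟩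
      applyUpTo (ω' c) n           ≡⟨ applyUpTo-cong (ω' c) (nth (pre c m)) n (λ i<n → ω'≡nth-pre {m} (≤-trans i<n n≤|pre|)) ⟩
      applyUpTo (nth (pre c m)) n  ≡⟨ applyUpTo-nth (pre c m) n n≤|pre| ⟩
      take n (pre c m)             ∎
    where open ≡-Reasoning

  L-ω'≤ : ∀ {m n} → n ≤ length (pre c m) → L (ω' c) n ≤ m + m
  L-ω'≤ {m} {n} n≤|pre| with Runs-pre c m
  ... | _ , _ , r = subst (λ xs → longestRun xs ≤ m + m) (sym (ω'-prefix {m} n≤|pre|)) (longestRun-take≤ n r)

  2^j≤⌊log₂n⌋ : ∀ {j n} → 2 ≤ j → length (pre c j) < n → 2 ^ j ≤ ⌊log₂ n ⌋
  2^j≤⌊log₂n⌋ {j} {n} 2≤j |pre|<n = begin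
      2 ^ j                  ≡⟨ sym (⌊log₂[2^n]⌋≡n (2 ^ j)) ⟩
      ⌊log₂ (2 ^ (2 ^ j)) ⌋  ≤⟨ ⌊log₂⌋-mono-≤ 2^2^j≤n ⟩
      ⌊log₂ n ⌋              ∎
    where
    open ≤-Reasoning
    2^2^j≤n : 2 ^ (2 ^ j) ≤ n
    2^2^j≤n = ≤-trans (^-monoˡ-≤ (2 ^ j) 2≤j) (≤-trans (l≤length-pre j 2≤j) (<⇒≤ |pre|<n))

mainTheorem7 : (c : ℕ → ℕ) → (∀ i → 1 ≤ i → IsCeilLog i (c i)) →
    ∀ k → 1 ≤ k → ∃ λ N → ∀ n → n ≥ N → k * L (ω' c) n ≤ ⌊log₂ n ⌋
mainTheorem7 c ceil k 1≤k = suc (length (pre c (4 * k))) , bound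
  where
  bound : ∀ n → n ≥ suc (length (pre c (4 * k))) → k * L (ω' c) n ≤ ⌊log₂ n ⌋
  bound n |pre-4k|<n with bracket (length ∘ pre c) (2 + n) (≤-trans (s≤s z≤n) |pre-4k|<n) (<⇒≤ (<length-pre c ceil n))
  ... | j , |pre-j|<n , n≤|pre-1+j| = begin
      k * L (ω' c) n       ≤⟨ *-monoʳ-≤ k (L-ω'≤ c ceil {suc j} n≤|pre-1+j|) ⟩
      k * (suc j + suc j)  ≤⟨ run-budget k j 4k≤j ⟩
      2 ^ j                ≤⟨ 2^j≤⌊log₂n⌋ c ceil 2≤j |pre-j|<n ⟩
      ⌊log₂ n ⌋            ∎
    where
    open ≤-Reasoning
    4k≤j : 4 * k ≤ j
    4k≤j with 4 * k ≤? j
    ... | yes 4k≤j = 4k≤j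
    ... | no  4k≰j = contradiction (≤-trans n≤|pre-1+j| (length-pre-mono c (≰⇒> 4k≰j))) (<⇒≱ |pre-4k|<n)
    2≤j : 2 ≤ j
    2≤j = ≤-trans (s≤s (s≤s z≤n)) (≤-trans (*-monoʳ-≤ 4 1≤k) 4k≤j)
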